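{- Let $\mathbf{A}$ be a Bochvar algebra and let $\{\mathbf{A}_i\}_{i\in I}$, $(I,\vee,i_0)$, $\{p_{ij}\}_{i\le j}$ be the Płonka decomposition of its involutive-bisemilattice reduct. For every $i\in I$, let $\top=J_2(1_i)$, where $1_i$ is the top element of $\mathbf{A}_i$. Then $\top\in A_{i_0}$ and the restriction of $J_2$ to $A_i$ is an isomorphism of Boolean algebras from $\mathbf{A}_i$ onto the interval Boolean algebra $[0,\top]=\langle[0,\top],\wedge,\vee,{}^*,0,\top\rangle$ of $\mathbf{A}_{i_0}$.
   Context: Let $\mathbf{WK}^e$ be the three-element algebra on $\{0,\tfrac12,1\}$ with $\neg 1=0,\neg\tfrac12=\tfrac12,\neg0=1$; $\vee,\wedge$ equal to $\tfrac12$ when one argument is $\tfrac12$ and Boolean otherwise; $J_0:0\mapsto1,\tfrac12\mapsto0,1\mapsto0$; $J_1:\tfrac12\mapsto1$, $0,1\mapsto 0$; $J_2:1\mapsto1$, $0,\tfrac12\mapsto0$. Bochvar algebras are the members of the quasivariety $\mathsf{BCA}=ISP(\mathbf{WK}^e)$. The $\{\wedge,\vee,\neg,0,1\}$-reduct of every Bochvar algebra is an involutive bisemilattice, and every involutive bisemilattice is (uniquely up to isomorphism) a Płonka sum of Boolean algebras: a join-semilattice $(I,\vee)$ with least element $i_0$, Boolean algebras $\mathbf{A}_i$ ($i\in I$, fibers) with disjoint universes, Boolean homomorphisms $p_{ij}:\mathbf{A}_i\to\mathbf{A}_j$ ($i\le j$) with $p_{ii}=\mathrm{id}$, $p_{jk}\circ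 p_{ij}=p_{ik}$; $A=\bigcup_iA_i$, operations computed as $g(a_1,\dots,a_n)=g^{\mathbf{A}_k}(p_{i_1k}(a_1),\dots,p_{i_nk}(a_n))$ with $a_m\in A_{i_m}$, $k=i_1\vee\dots\vee i_n$, constants from $\mathbf{A}_{i_0}$ (the Płonka decomposition). For a Boolean algebra $\mathbf{B}$ and $c\in B$, the interval Boolean algebra $[0,c]$ has universe $\{x\in B: x\le c\}$, the restricted meet and join, bottom $0$, top $c$ and complement $x^*=\neg x\wedge c$. -}

module Defs where

open import Data.Product using (Σ; Σ-syntax; _×_; _,_; proj₁)
open import Relation.Binary.PropositionalEquality
  using (_≡_; refl; sym; trans; cong; cong₂)
open import Algebra.Core using (Op₁; Op₂)
open import Algebra.Structures using (IsIdempotentCommutativeMonoid)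
import Algebra.Lattice.Structures as LS

data WK : Set where
  𝟘 ½ 𝟙 : WK

¬W : WK → WK
¬W 𝟘 = 𝟙
¬W ½ = ½
¬W 𝟙 = 𝟘

_∧W_ : WK → WK → WK
½ ∧W _ = ½
_ ∧W ½ = ½
𝟘 ∧W _ = 𝟘
𝟙 ∧W y = y

_∨W_ : WK → WK → WK
½ ∨W _ = ½
_ ∨W ½ = ½
𝟙 ∨W _ = 𝟙
𝟘 ∨W y = y

J0W : WK → WK
J0W 𝟘 = 𝟙
J0W ½ = 𝟘
J0W 𝟙 = 𝟘

J1W : WK → WK
J1W 𝟘 = 𝟘
J1W ½ = 𝟙
J1W 𝟙 = 𝟘

J2W : WK → WK
J2W 𝟘 = 𝟘
J2W ½ = 𝟘
J2W 𝟙 = 𝟙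

record BSig (A : Set) : Set where
  field
    _∧_ _∨_ : A → A → A
    ¬_ J₀ J₁ J₂ : A → A
    𝟎 𝟏 : A

-- A ∈ ISP(WK^e): A embeds (injective homomorphism) into a power WK^X.
-- Equality in WK^X is pointwise.
record IsBochvar {A : Set} (S : BSig A) : Set₁ where
  open BSig S
  field
    X : Set
    e : A → X → WK
    e-inj : ∀ a b → (∀ x → e a x ≡ e b x) → a ≡ b
    e-∧ : ∀ a b x → e (a ∧ b) x ≡ (e a x ∧W e b x)
    e-∨ : ∀ a b x → e (a ∨ b) x ≡ (e a x ∨W e b x)
    e-¬ : ∀ a x → e (¬ a) x ≡ ¬W (e a x)
    e-J₀ : ∀ a x → e (J₀ a) x ≡ J0W (e a x)
    e-J₁ : ∀ a x → e (J₁ a) x ≡ J1W (e a x)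
    e-J₂ : ∀ a x → e (J₂ a) x ≡ J2W (e a x)
    e-𝟎 : ∀ x → e 𝟎 x ≡ 𝟘
    e-𝟏 : ∀ x → e 𝟏 x ≡ 𝟙

record BochvarAlgebra : Set₁ where
  field
    Carrier : Set
    sig : BSig Carrier
    isBochvar : IsBochvar sig
  open BSig sig public

-- Płonka decomposition of the {∧,∨,¬,0,1}-reduct, represented on the
-- carrier itself: ι assigns to each element its fiber index; the fiber
-- A_i = { a | ι a ≡ i } carries the restricted operations ∧, ∨, ¬ and
-- its own bottom ⊥ᶠ i and top ⊤ᶠ i.

record PlonkaIndex {A : Set} (S : BSig A) : Set₁ where
  open BSig S
  field
    I : Set
    _⊔_ : I → I → I
    i₀ : I
    isSemilattice : IsIdempotentCommutativeMonoid _≡_ _⊔_ i₀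
    ι : A → I
    ⊥ᶠ ⊤ᶠ : I → A
    ι-⊥ᶠ : ∀ i → ι (⊥ᶠ i) ≡ i
    ι-⊤ᶠ : ∀ i → ι (⊤ᶠ i) ≡ i
    ι-∧ : ∀ a b → ι (a ∧ b) ≡ ι a ⊔ ι b
    ι-∨ : ∀ a b → ι (a ∨ b) ≡ ι a ⊔ ι b
    ι-¬ : ∀ a → ι (¬ a) ≡ ι a

  _≤I_ : I → I → Set
  i ≤I j = i ⊔ j ≡ j

  open IsIdempotentCommutativeMonoid isSemilattice using (idem)

  Fiber : I → Set
  Fiber i = Σ[ a ∈ A ] ι a ≡ i

  _≈ᶠ_ : ∀ {i} → Fiber i → Fiber i → Set
  (a , _) ≈ᶠ (b , _) = a ≡ b

  ∧ᶠ : ∀ i → Op₂ (Fiber i)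
  ∧ᶠ i (a , pa) (b , pb) = a ∧ b , trans (ι-∧ a b) (trans (cong₂ _⊔_ pa pb) (idem i))

  ∨ᶠ : ∀ i → Op₂ (Fiber i)
  ∨ᶠ i (a , pa) (b , pb) = a ∨ b , trans (ι-∨ a b) (trans (cong₂ _⊔_ pa pb) (idem i))

  ¬ᶠ : ∀ i → Op₁ (Fiber i)
  ¬ᶠ i (a , pa) = ¬ a , trans (ι-¬ a) pa

  botᶠ topᶠ : ∀ i → Fiber i
  botᶠ i = ⊥ᶠ i , ι-⊥ᶠ i
  topᶠ i = ⊤ᶠ i , ι-⊤ᶠ i

record PlonkaDecomposition {A : Set} (S : BSig A) : Set₁ where
  open BSig S
  field
    index : PlonkaIndex S
  open PlonkaIndex index public
  field
    fiberBA : ∀ i → LS.IsBooleanAlgebra (_≈ᶠ_ {i}) (∨ᶠ i) (∧ᶠ i) (¬ᶠ i) (topᶠ i) (botᶠ i)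
    p : I → I → A → A
    p-fiber : ∀ i j a → i ≤I j → ι a ≡ i → ι (p i j a) ≡ j
    p-∧ : ∀ i j a b → i ≤I j → ι a ≡ i → ι b ≡ i → p i j (a ∧ b) ≡ p i j a ∧ p i j b
    p-∨ : ∀ i j a b → i ≤I j → ι a ≡ i → ι b ≡ i → p i j (a ∨ b) ≡ p i j a ∨ p i j b
    p-¬ : ∀ i j a → i ≤I j → ι a ≡ i → p i j (¬ a) ≡ ¬ (p i j a)
    p-⊥ : ∀ i j → i ≤I j → p i j (⊥ᶠ i) ≡ ⊥ᶠ j
    p-⊤ : ∀ i j → i ≤I j → p i j (⊤ᶠ i) ≡ ⊤ᶠ j
    p-id : ∀ i a → ι a ≡ i → p i i a ≡ a
    p-comp : ∀ i j k a → i ≤I j → j ≤I k → ι a ≡ i → p j k (p i j a) ≡ p i k a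
    ∧-sum : ∀ a b → a ∧ b ≡ p (ι a) (ι a ⊔ ι b) a ∧ p (ι b) (ι a ⊔ ι b) b
    ∨-sum : ∀ a b → a ∨ b ≡ p (ι a) (ι a ⊔ ι b) a ∨ p (ι b) (ι a ⊔ ι b) b
    𝟎-sum : 𝟎 ≡ ⊥ᶠ i₀
    𝟏-sum : 𝟏 ≡ ⊤ᶠ i₀

-- "f restricted to A_i is a Boolean-algebra isomorphism from 𝐀ᵢ onto the
-- interval algebra [0,c] = ⟨[0,c], ∧, ∨, *, 0, c⟩ of 𝐀_j", where
-- x ≤ c in 𝐀_j means x ∧ c ≡ x, and x* = ¬ x ∧ c.

record IsIntervalIso {A : Set} {S : BSig A} (D : PlonkaDecomposition S)
                     (f : A → A) (i j : PlonkaDecomposition.I D) (c : A) : Set where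
  open BSig S
  open PlonkaDecomposition D
  InInterval : A → Set
  InInterval x = (ι x ≡ j) × (x ∧ c ≡ x)
  field
    into : ∀ a → ι a ≡ i → InInterval (f a)
    injective : ∀ a b → ι a ≡ i → ι b ≡ i → f a ≡ f b → a ≡ b
    surjective : ∀ x → InInterval x → Σ[ a ∈ A ] (ι a ≡ i) × (f a ≡ x)
    pres-∧ : ∀ a b → ι a ≡ i → ι b ≡ i → f (a ∧ b) ≡ f a ∧ f b
    pres-∨ : ∀ a b → ι a ≡ i → ι b ≡ i → f (a ∨ b) ≡ f a ∨ f b
    pres-¬ : ∀ a → ι a ≡ i → f (¬ a) ≡ (¬ (f a)) ∧ c
    pres-⊥ : f (⊥ᶠ i) ≡ ⊥ᶠ j
    pres-⊤ : f (⊤ᶠ i) ≡ c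

-- Embed the Bochvar algebra into a power of WK^e and compute coordinatewise.
-- Two elements lie in the same Płonka fiber exactly when they have the same
-- value a ∨ ¬a, i.e. the same set of coordinates equal to ½. On such a fiber
-- J₂ is injective (the ½-coordinates are already fixed by the fiber), it
-- lands in the Boolean fiber i₀, and it sends the fiber top to the largest
-- Boolean element vanishing on the ½-coordinates. Every claimed identity then
-- reduces to a finite check in WK^e.
module Submission where

open import Defs
open import Data.Product using (_×_; _,_; proj₂)
open import Relation.Binary.PropositionalEquality
  using (_≡_; refl; sym; trans; cong; cong₂; module ≡-Reasoning)
open import Algebra.Structures using (IsIdempotentCommutativeMonoid)
import Algebra.Lattice.Structures as LS

fiberTopW : WK → WK
fiberTopW u = u ∨W ¬W u

J2W-Boolean : ∀ u → fiberTopW (J2W u) ≡ 𝟙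
J2W-Boolean 𝟘 = refl
J2W-Boolean ½ = refl
J2W-Boolean 𝟙 = refl

J2W-∧ : ∀ u v → J2W (u ∧W v) ≡ J2W u ∧W J2W v
J2W-∧ 𝟘 𝟘 = refl
J2W-∧ 𝟘 ½ = refl
J2W-∧ 𝟘 𝟙 = refl
J2W-∧ ½ 𝟘 = refl
J2W-∧ ½ ½ = refl
J2W-∧ ½ 𝟙 = refl
J2W-∧ 𝟙 𝟘 = refl
J2W-∧ 𝟙 ½ = refl
J2W-∧ 𝟙 𝟙 = refl

J2W-∨ : ∀ u v → fiberTopW u ≡ fiberTopW v → J2W (u ∨W v) ≡ J2W u ∨W J2W v
J2W-∨ 𝟘 𝟘 _ = refl
J2W-∨ 𝟘 𝟙 _ = refl
J2W-∨ 𝟙 𝟘 _ = refl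
J2W-∨ 𝟙 𝟙 _ = refl
J2W-∨ ½ ½ _ = refl
J2W-∨ 𝟘 ½ ()
J2W-∨ 𝟙 ½ ()
J2W-∨ ½ 𝟘 ()
J2W-∨ ½ 𝟙 ()

J2W-¬ : ∀ u → J2W (¬W u) ≡ ¬W (J2W u) ∧W J2W (fiberTopW u)
J2W-¬ 𝟘 = refl
J2W-¬ ½ = refl
J2W-¬ 𝟙 = refl

J2W-∧-J2W-fiberTop : ∀ u → J2W u ∧W J2W (fiberTopW u) ≡ J2W u
J2W-∧-J2W-fiberTop 𝟘 = refl
J2W-∧-J2W-fiberTop ½ = refl
J2W-∧-J2W-fiberTop 𝟙 = refl

J2W-∧-¬ : ∀ u → J2W (u ∧W ¬W u) ≡ 𝟘
J2W-∧-¬ 𝟘 = refl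
J2W-∧-¬ ½ = refl
J2W-∧-¬ 𝟙 = refl

J2W-injective : ∀ u v → fiberTopW u ≡ fiberTopW v → J2W u ≡ J2W v → u ≡ v
J2W-injective 𝟘 𝟘 _ _ = refl
J2W-injective ½ ½ _ _ = refl
J2W-injective 𝟙 𝟙 _ _ = refl
J2W-injective 𝟘 ½ () _
J2W-injective 𝟘 𝟙 _ ()
J2W-injective ½ 𝟘 () _
J2W-injective ½ 𝟙 () _
J2W-injective 𝟙 𝟘 _ ()
J2W-injective 𝟙 ½ () _

J2W-∧-fiberTop : ∀ w s → fiberTopW w ≡ 𝟙 → w ∧W J2W (fiberTopW s) ≡ w →
                 J2W (w ∧W fiberTopW s) ≡ w
J2W-∧-fiberTop 𝟘 𝟘 _ _ = refl
J2W-∧-fiberTop 𝟘 ½ _ _ = refl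
J2W-∧-fiberTop 𝟘 𝟙 _ _ = refl
J2W-∧-fiberTop 𝟙 𝟘 _ _ = refl
J2W-∧-fiberTop 𝟙 𝟙 _ _ = refl
J2W-∧-fiberTop ½ _ () _
J2W-∧-fiberTop 𝟙 ½ _ ()

module BochvarIdentities (𝐀 : BochvarAlgebra) where
  open BochvarAlgebra 𝐀
  open IsBochvar isBochvar
  open ≡-Reasoning

  e-cong : ∀ {a b} → a ≡ b → ∀ x → e a x ≡ e b x
  e-cong a≡b x = cong (λ c → e c x) a≡b

  e-fiberTop : ∀ a x → e (a ∨ (¬ a)) x ≡ fiberTopW (e a x)
  e-fiberTop a x = trans (e-∨ a (¬ a) x) (cong (e a x ∨W_) (e-¬ a x))

  e-fiberTop-cong : ∀ {a b} → a ∨ (¬ a) ≡ b ∨ (¬ b) → ∀ x → fiberTopW (e a x) ≡ fiberTopW (e b x)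
  e-fiberTop-cong {a} {b} eq x =
    trans (sym (e-fiberTop a x)) (trans (e-cong eq x) (e-fiberTop b x))

  J₂-∨-¬ : ∀ a → J₂ a ∨ (¬ J₂ a) ≡ 𝟏
  J₂-∨-¬ a = e-inj _ _ λ x → begin
    e (J₂ a ∨ (¬ J₂ a)) x     ≡⟨ e-fiberTop (J₂ a) x ⟩
    fiberTopW (e (J₂ a) x)    ≡⟨ cong fiberTopW (e-J₂ a x) ⟩
    fiberTopW (J2W (e a x))   ≡⟨ J2W-Boolean (e a x) ⟩
    𝟙                         ≡⟨ sym (e-𝟏 x) ⟩
    e 𝟏 x                     ∎

  J₂-∧ : ∀ a b → J₂ (a ∧ b) ≡ J₂ a ∧ J₂ b
  J₂-∧ a b = e-inj _ _ λ x → begin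
    e (J₂ (a ∧ b)) x             ≡⟨ e-J₂ (a ∧ b) x ⟩
    J2W (e (a ∧ b) x)            ≡⟨ cong J2W (e-∧ a b x) ⟩
    J2W (e a x ∧W e b x)         ≡⟨ J2W-∧ (e a x) (e b x) ⟩
    J2W (e a x) ∧W J2W (e b x)   ≡⟨ sym (cong₂ _∧W_ (e-J₂ a x) (e-J₂ b x)) ⟩
    e (J₂ a) x ∧W e (J₂ b) x     ≡⟨ sym (e-∧ (J₂ a) (J₂ b) x) ⟩
    e (J₂ a ∧ J₂ b) x            ∎

  J₂-∨ : ∀ a b → a ∨ (¬ a) ≡ b ∨ (¬ b) → J₂ (a ∨ b) ≡ J₂ a ∨ J₂ b
  J₂-∨ a b eq = e-inj _ _ λ x → begin
    e (J₂ (a ∨ b)) x             ≡⟨ e-J₂ (a ∨ b) x ⟩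
    J2W (e (a ∨ b) x)            ≡⟨ cong J2W (e-∨ a b x) ⟩
    J2W (e a x ∨W e b x)         ≡⟨ J2W-∨ (e a x) (e b x) (e-fiberTop-cong eq x) ⟩
    J2W (e a x) ∨W J2W (e b x)   ≡⟨ sym (cong₂ _∨W_ (e-J₂ a x) (e-J₂ b x)) ⟩
    e (J₂ a) x ∨W e (J₂ b) x     ≡⟨ sym (e-∨ (J₂ a) (J₂ b) x) ⟩
    e (J₂ a ∨ J₂ b) x            ∎

  e-J₂-fiberTop : ∀ a x → e (J₂ (a ∨ (¬ a))) x ≡ J2W (fiberTopW (e a x))
  e-J₂-fiberTop a x = trans (e-J₂ (a ∨ (¬ a)) x) (cong J2W (e-fiberTop a x))

  J₂-¬ : ∀ a → J₂ (¬ a) ≡ (¬ J₂ a) ∧ J₂ (a ∨ (¬ a))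
  J₂-¬ a = e-inj _ _ λ x → begin
    e (J₂ (¬ a)) x                                ≡⟨ e-J₂ (¬ a) x ⟩
    J2W (e (¬ a) x)                               ≡⟨ cong J2W (e-¬ a x) ⟩
    J2W (¬W (e a x))                              ≡⟨ J2W-¬ (e a x) ⟩
    ¬W (J2W (e a x)) ∧W J2W (fiberTopW (e a x))   ≡⟨ sym (cong₂ _∧W_ (e-¬J₂ x) (e-J₂-fiberTop a x)) ⟩
    e (¬ J₂ a) x ∧W e (J₂ (a ∨ (¬ a))) x          ≡⟨ sym (e-∧ (¬ J₂ a) (J₂ (a ∨ (¬ a))) x) ⟩
    e ((¬ J₂ a) ∧ J₂ (a ∨ (¬ a))) x               ∎
    where
    e-¬J₂ : ∀ x → e (¬ J₂ a) x ≡ ¬W (J2W (e a x))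
    e-¬J₂ x = trans (e-¬ (J₂ a) x) (cong ¬W (e-J₂ a x))

  J₂-∧-J₂-fiberTop : ∀ a → J₂ a ∧ J₂ (a ∨ (¬ a)) ≡ J₂ a
  J₂-∧-J₂-fiberTop a = e-inj _ _ λ x → begin
    e (J₂ a ∧ J₂ (a ∨ (¬ a))) x              ≡⟨ e-∧ (J₂ a) (J₂ (a ∨ (¬ a))) x ⟩
    e (J₂ a) x ∧W e (J₂ (a ∨ (¬ a))) x       ≡⟨ cong₂ _∧W_ (e-J₂ a x) (e-J₂-fiberTop a x) ⟩
    J2W (e a x) ∧W J2W (fiberTopW (e a x))   ≡⟨ J2W-∧-J2W-fiberTop (e a x) ⟩
    J2W (e a x)                              ≡⟨ sym (e-J₂ a x) ⟩
    e (J₂ a) x                               ∎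

  J₂-∧-¬ : ∀ a → J₂ (a ∧ (¬ a)) ≡ 𝟎
  J₂-∧-¬ a = e-inj _ _ λ x → begin
    e (J₂ (a ∧ (¬ a))) x        ≡⟨ e-J₂ (a ∧ (¬ a)) x ⟩
    J2W (e (a ∧ (¬ a)) x)       ≡⟨ cong J2W (trans (e-∧ a (¬ a) x) (cong (e a x ∧W_) (e-¬ a x))) ⟩
    J2W (e a x ∧W ¬W (e a x))   ≡⟨ J2W-∧-¬ (e a x) ⟩
    𝟘                           ≡⟨ sym (e-𝟎 x) ⟩
    e 𝟎 x                       ∎

  J₂-injective : ∀ a b → a ∨ (¬ a) ≡ b ∨ (¬ b) → J₂ a ≡ J₂ b → a ≡ b
  J₂-injective a b eq J₂a≡J₂b = e-inj a b λ x →
    J2W-injective (e a x) (e b x) (e-fiberTop-cong eq x)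
      (trans (sym (e-J₂ a x)) (trans (e-cong J₂a≡J₂b x) (e-J₂ b x)))

  J₂-∧-fiberTop : ∀ w s → w ∨ (¬ w) ≡ 𝟏 → w ∧ J₂ (s ∨ (¬ s)) ≡ w → J₂ (w ∧ (s ∨ (¬ s))) ≡ w
  J₂-∧-fiberTop w s w-Boolean w≤ = e-inj _ _ λ x → begin
    e (J₂ (w ∧ (s ∨ (¬ s)))) x         ≡⟨ e-J₂ (w ∧ (s ∨ (¬ s))) x ⟩
    J2W (e (w ∧ (s ∨ (¬ s))) x)        ≡⟨ cong J2W (trans (e-∧ w (s ∨ (¬ s)) x) (cong (e w x ∧W_) (e-fiberTop s x))) ⟩
    J2W (e w x ∧W fiberTopW (e s x))   ≡⟨ J2W-∧-fiberTop (e w x) (e s x) (w-Booleanₓ x) (w≤ₓ x) ⟩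
    e w x                              ∎
    where
    w-Booleanₓ : ∀ x → fiberTopW (e w x) ≡ 𝟙
    w-Booleanₓ x = trans (sym (e-fiberTop w x)) (trans (e-cong w-Boolean x) (e-𝟏 x))
    w≤ₓ : ∀ x → e w x ∧W J2W (fiberTopW (e s x)) ≡ e w x
    w≤ₓ x = trans (cong (e w x ∧W_) (sym (e-J₂-fiberTop s x)))
              (trans (sym (e-∧ w (J₂ (s ∨ (¬ s))) x)) (e-cong w≤ x))

module PlonkaFibers (𝐀 : BochvarAlgebra) (D : PlonkaDecomposition (BochvarAlgebra.sig 𝐀)) where
  open BochvarAlgebra 𝐀
  open PlonkaDecomposition D
  open IsIdempotentCommutativeMonoid isSemilattice using (idem; identityˡ)
  open BochvarIdentities 𝐀

  ∨-¬-fiber : ∀ {i} a → ι a ≡ i → a ∨ (¬ a) ≡ ⊤ᶠ i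
  ∨-¬-fiber {i} a ιa≡i = proj₂ (LS.IsBooleanAlgebra.∨-complement (fiberBA i)) (a , ιa≡i)

  ∧-¬-fiber : ∀ {i} a → ι a ≡ i → a ∧ (¬ a) ≡ ⊥ᶠ i
  ∧-¬-fiber {i} a ιa≡i = proj₂ (LS.IsBooleanAlgebra.∧-complement (fiberBA i)) (a , ιa≡i)

  ∨-¬-same-fiber : ∀ {i} a b → ι a ≡ i → ι b ≡ i → a ∨ (¬ a) ≡ b ∨ (¬ b)
  ∨-¬-same-fiber a b ιa≡i ιb≡i = trans (∨-¬-fiber a ιa≡i) (sym (∨-¬-fiber b ιb≡i))

  ι-∨-¬ : ∀ a → ι (a ∨ (¬ a)) ≡ ι a
  ι-∨-¬ a = trans (ι-∨ a (¬ a)) (trans (cong (ι a ⊔_) (ι-¬ a)) (idem (ι a)))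

  ι-J₂ : ∀ a → ι (J₂ a) ≡ i₀
  ι-J₂ a = begin
    ι (J₂ a)              ≡⟨ sym (ι-∨-¬ (J₂ a)) ⟩
    ι (J₂ a ∨ (¬ J₂ a))   ≡⟨ cong ι (trans (J₂-∨-¬ a) 𝟏-sum) ⟩
    ι (⊤ᶠ i₀)             ≡⟨ ι-⊤ᶠ i₀ ⟩
    i₀                    ∎
    where open ≡-Reasoning

  ∨-¬-bottom-fiber : ∀ a → ι a ≡ i₀ → a ∨ (¬ a) ≡ 𝟏
  ∨-¬-bottom-fiber a ιa≡i₀ = trans (∨-¬-fiber a ιa≡i₀) (sym 𝟏-sum)

  ι-∧-⊤ᶠ : ∀ i a → ι a ≡ i₀ → ι (a ∧ ⊤ᶠ i) ≡ i
  ι-∧-⊤ᶠ i a ιa≡i₀ = trans (ι-∧ a (⊤ᶠ i)) (trans (cong₂ _⊔_ ιa≡i₀ (ι-⊤ᶠ i)) (identityˡ i))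

  J₂-fiberIso : ∀ i → IsIntervalIso D J₂ i i₀ (J₂ (⊤ᶠ i))
  J₂-fiberIso i = record
    { into        = λ a ιa≡i → ι-J₂ a , J₂-below a ιa≡i
    ; injective   = λ a b ιa≡i ιb≡i → J₂-injective a b (∨-¬-same-fiber a b ιa≡i ιb≡i)
    ; surjective  = λ y (ιy≡i₀ , y≤⊤) → y ∧ ⊤ᶠ i , ι-∧-⊤ᶠ i y ιy≡i₀ , J₂-preimage y ιy≡i₀ y≤⊤
    ; pres-∧      = λ a b _ _ → J₂-∧ a b
    ; pres-∨      = λ a b ιa≡i ιb≡i → J₂-∨ a b (∨-¬-same-fiber a b ιa≡i ιb≡i)
    ; pres-¬      = λ a ιa≡i → trans (J₂-¬ a) (cong (λ t → (¬ J₂ a) ∧ J₂ t) (∨-¬-fiber a ιa≡i))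
    ; pres-⊥      = trans (cong J₂ (sym (∧-¬-fiber (⊤ᶠ i) (ι-⊤ᶠ i))))
                      (trans (J₂-∧-¬ (⊤ᶠ i)) 𝟎-sum)
    ; pres-⊤      = refl
    }
    where
    ⊤ᶠ-as-∨-¬ : ⊤ᶠ i ≡ ⊤ᶠ i ∨ (¬ ⊤ᶠ i)
    ⊤ᶠ-as-∨-¬ = sym (∨-¬-fiber (⊤ᶠ i) (ι-⊤ᶠ i))

    J₂-below : ∀ a → ι a ≡ i → J₂ a ∧ J₂ (⊤ᶠ i) ≡ J₂ a
    J₂-below a ιa≡i =
      trans (cong (λ t → J₂ a ∧ J₂ t) (sym (∨-¬-fiber a ιa≡i))) (J₂-∧-J₂-fiberTop a)

    -- y ∧ ⊤ᶠ i is the image of y under the Płonka map p i₀ i.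
    J₂-preimage : ∀ y → ι y ≡ i₀ → y ∧ J₂ (⊤ᶠ i) ≡ y → J₂ (y ∧ ⊤ᶠ i) ≡ y
    J₂-preimage y ιy≡i₀ y≤⊤ =
      trans (cong (λ t → J₂ (y ∧ t)) ⊤ᶠ-as-∨-¬)
        (J₂-∧-fiberTop y (⊤ᶠ i) (∨-¬-bottom-fiber y ιy≡i₀)
          (trans (cong (λ t → y ∧ J₂ t) (sym ⊤ᶠ-as-∨-¬)) y≤⊤))

proposition2p12 : (𝐀 : BochvarAlgebra)
    (D : PlonkaDecomposition (BochvarAlgebra.sig 𝐀))
    (i : PlonkaDecomposition.I D)
    → (PlonkaDecomposition.ι D (BochvarAlgebra.J₂ 𝐀 (PlonkaDecomposition.⊤ᶠ D i)) ≡ PlonkaDecomposition.i₀ D)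
    × IsIntervalIso D (BochvarAlgebra.J₂ 𝐀) i (PlonkaDecomposition.i₀ D)
    (BochvarAlgebra.J₂ 𝐀 (PlonkaDecomposition.⊤ᶠ D i))
proposition2p12 𝐀 D i = ι-J₂ (⊤ᶠ i) , J₂-fiberIso i
  where
  open BochvarAlgebra 𝐀 using (J₂)
  open PlonkaDecomposition D using (⊤ᶠ)
  open PlonkaFibers 𝐀 D using (ι-J₂; J₂-fiberIso)
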